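{- Let $n\geq 2$, let $k_1\geq 0$ be an integer and $m=3k_1+2$. If there exist integers $a,b\geq 0$ such that $a+b=n-1$ and ($a-2b\equiv 2\pmod m$ or $a-2b\equiv m-1\pmod m$), then $\gamma(\overrightarrow{C_m}\Box \overrightarrow{C_n})=n(k_1+1)$.
   Context: For a digraph $D$, a vertex $u$ dominates $v$ if $u=v$ or $uv$ is an arc; $\gamma(D)$ is the minimum size of a set of vertices dominating every vertex. The directed cycle $\overrightarrow{C_n}$ has vertex set $\{0,\dots,n-1\}$ (integers mod $n$) and arcs $x\to x+1\pmod n$. The Cartesian product $D_1\Box D_2$ has vertex set $V_1\times V_2$ and an arc $(x_1,x_2)\to(y_1,y_2)$ iff either $x_1\to y_1$ is an arc of $D_1$ and $x_2=y_2$, or $x_2\to y_2$ is an arc of $D_2$ and $x_1=y_1$. -}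

module Defs where

open import Data.Nat using (ℕ; suc; _+_; _≤_)
open import Data.Fin using (Fin; toℕ)
open import Data.Product using (_×_; _,_; Σ; ∃)
open import Data.Sum using (_⊎_)
open import Data.List using (List; length)
open import Data.List.Membership.Propositional using (_∈_)
open import Data.List.Relation.Unary.Unique.Propositional using (Unique)
open import Relation.Binary.PropositionalEquality using (_≡_)

record Digraph : Set₁ where
  field
    V   : Set
    Arc : V → V → Set
open Digraph public

Dominates : (D : Digraph) → V D → V D → Set
Dominates D u v = (u ≡ v) ⊎ Arc D u v

-- A dominating set, represented as a duplicate-free list of vertices
-- (its size is the length of the list).
IsDominatingSet : (D : Digraph) → List (V D) → Set
IsDominatingSet D S = Unique S × (∀ v → ∃ λ u → (u ∈ S) × Dominates D u v)

DominationNumber≡ : Digraph → ℕ → Set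
DominationNumber≡ D k =
  (Σ (List (V D)) λ S → IsDominatingSet D S × length S ≡ k)
  × (∀ S → IsDominatingSet D S → k ≤ length S)

DirCycle : ℕ → Digraph
DirCycle n = record
  { V = Fin n
  ; Arc = λ x y → (suc (toℕ x) ≡ toℕ y) ⊎ ((suc (toℕ x) ≡ n) × (toℕ y ≡ 0))
  }

_□_ : Digraph → Digraph → Digraph
D₁ □ D₂ = record
  { V = V D₁ × V D₂
  ; Arc = λ { (x₁ , x₂) (y₁ , y₂) →
      (Arc D₁ x₁ y₁ × (x₂ ≡ y₂)) ⊎ (Arc D₂ x₂ y₂ × (x₁ ≡ y₁)) }
  }

module Submission where

-- View the torus as n columns (copies of C_m) arranged along C_n; pred j is the column whose
-- arcs enter column j.
--
-- Lower bound (any n ≥ 1): a vertex dominates at most two vertices of its own column and one of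
-- the next, so the column counts satisfy 3k+2 ≤ 2dⱼ + d_{pred j}.  This gives the local trade-off
-- (k+1) + (dⱼ ∸ (k+1)) ≤ dⱼ + (d_{pred j} ∸ (k+1)); summing around the cycle of columns and
-- cancelling the rotation-invariant surplus Σ (dⱼ ∸ (k+1)) yields Σ dⱼ ≥ n(k+1).
--
-- Upper bound: column j gets the k+1 vertices at offsets 0, 3, ..., 3k from a base point; if
-- consecutive base points differ by 1 or 3k modulo m, all vertices are dominated.  A staircase of
-- A unit steps and B steps of 3k closes up around C_n when m ∣ A + 3kB, and the hypothesis
-- provides such A + B = n.

open import Defs
open import Data.Nat using (ℕ; zero; suc; _+_; _*_; _≤_; _<_; _∸_; _%_; z≤n; s≤s; z<s; NonZero; >-nonZero; >-nonZero⁻¹)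
open import Data.Nat.Properties
open import Data.Nat.Divisibility using (n∣m⇒m%n≡0) renaming (_∣_ to _∣ℕ_)
open import Data.Nat.DivMod using (_mod_; _divMod_; result; %-distribˡ-+; m%n%n≡m%n; [m+n]%n≡m%n; m<n⇒m%n≡m; m%n≤n; m%n<n; n%n≡0)
open import Data.Nat.Tactic.RingSolver using (solve-∀)
open import Data.Integer using (ℤ; +_; _-_)
import Data.Integer as ℤ
import Data.Integer.Properties as ℤₚ
open import Data.Integer.Divisibility using (_∣_)
import Data.Integer.Divisibility.Signed as Signed
open import Data.Integer.Tactic.RingSolver using () renaming (solve-∀ to ℤ-solve-∀)
open import Data.Fin as Fin using (Fin; toℕ; fromℕ; fromℕ<; inject₁; remQuot; combine)
import Data.Fin.Properties as Finₚ
open import Data.List using (List; []; _∷_; _++_; length; map; concatMap; allFin; tabulate; deduplicate)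
open import Data.List.Properties using (length-removeAt′; length-deduplicate; length-++; length-map; length-tabulate)
open import Data.List.Relation.Unary.Any using (here; there; _─_)
import Data.List.Relation.Unary.All as All
open import Data.List.Relation.Unary.AllPairs using (_∷_)
open import Data.List.Membership.Propositional using (_∈_; lose)
open import Data.List.Membership.Propositional.Properties using (∈-deduplicate⁺; ∈-map⁻; ∈-concatMap⁺; ∈-tabulate⁺)
open import Data.List.Relation.Unary.Unique.Propositional using (Unique)
open import Data.List.Relation.Unary.Unique.DecPropositional.Properties using (deduplicate-!; map⁺; allFin⁺)
open import Data.Product using (Σ; _×_; _,_; proj₁; proj₂; ∃)
open import Data.Product.Properties using (≡-dec)
open import Data.Sum using (_⊎_; inj₁; inj₂)
import Data.Sum as Sum
open import Function using (_∘_; id)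
open import Algebra.Properties.CommutativeSemigroup +-commutativeSemigroup using (x∙yz≈y∙xz)
open import Algebra.Properties.CommutativeMonoid.Sum +-0-commutativeMonoid using (sum-syntax; sum-init-last; ∑-distrib-+)
open import Relation.Nullary using (yes; no; contradiction)
open import Relation.Binary.Definitions using (DecidableEquality)
open import Relation.Binary.PropositionalEquality using (_≡_; _≢_; refl; sym; trans; cong; cong₂; subst; module ≡-Reasoning)

∈-─⁺ : {A : Set} {x z : A} {ys : List A} (x∈ys : x ∈ ys) → z ∈ ys → z ≢ x → z ∈ (ys ─ x∈ys)
∈-─⁺ (here refl)  (here refl)  z≢x = contradiction refl z≢x
∈-─⁺ (here refl)  (there z∈ys) z≢x = z∈ys
∈-─⁺ (there x∈ys) (here z≡y)   z≢x = here z≡y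
∈-─⁺ (there x∈ys) (there z∈ys) z≢x = there (∈-─⁺ x∈ys z∈ys z≢x)

unique-⊆⇒length≤ : {A : Set} {xs ys : List A} → Unique xs → (∀ {z} → z ∈ xs → z ∈ ys) →
                   length xs ≤ length ys
unique-⊆⇒length≤ {xs = []}     _             _   = z≤n
unique-⊆⇒length≤ {xs = x ∷ xs} {ys} (x∉xs ∷ xs!) xs⊆ys = begin
  suc (length xs)         ≤⟨ s≤s (unique-⊆⇒length≤ xs! xs⊆ys─x) ⟩
  suc (length (ys ─ x∈ys)) ≡⟨ length-removeAt′ ys _ ⟨
  length ys               ∎
  where
  open ≤-Reasoning
  x∈ys = xs⊆ys (here refl)
  xs⊆ys─x : ∀ {z} → z ∈ xs → z ∈ (ys ─ x∈ys)
  xs⊆ys─x z∈xs = ∈-─⁺ x∈ys (xs⊆ys (there z∈xs)) (λ z≡x → All.lookup x∉xs z∈xs (sym z≡x))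

Covers : (D : Digraph) → List (V D) → Set
Covers D L = ∀ v → ∃ λ u → (u ∈ L) × Dominates D u v

-- γ(D) = k follows from a lower bound k on all dominating sets together with a dominating
-- list of length at most k: removing duplicates from the list yields a dominating set.
γ-from-bounds : (D : Digraph) (_≟_ : DecidableEquality (V D)) (k : ℕ) →
                (∀ S → IsDominatingSet D S → k ≤ length S) →
                (L : List (V D)) → Covers D L → length L ≤ k → DominationNumber≡ D k
γ-from-bounds D _≟_ k lower L covers |L|≤k =
  (S , isDominating , ≤-antisym (≤-trans (length-deduplicate _≟_ L) |L|≤k) (lower S isDominating))
  , lower
  where
  S = deduplicate _≟_ L
  isDominating : IsDominatingSet D S
  isDominating = deduplicate-! _≟_ L , λ v → let (u , u∈L , u↦v) = covers v in u , ∈-deduplicate⁺ _≟_ u∈L , u↦v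

module Modular (m : ℕ) .{{_ : NonZero m}} where
  open ≡-Reasoning

  %-absorbˡ : ∀ a b → (a % m + b) % m ≡ (a + b) % m
  %-absorbˡ a b = begin
    (a % m + b) % m          ≡⟨ %-distribˡ-+ (a % m) b m ⟩
    (a % m % m + b % m) % m  ≡⟨ cong (λ x → (x + b % m) % m) (m%n%n≡m%n a m) ⟩
    (a % m + b % m) % m      ≡⟨ %-distribˡ-+ a b m ⟨
    (a + b) % m              ∎

  %-absorbʳ : ∀ a b → (a + b % m) % m ≡ (a + b) % m
  %-absorbʳ a b = begin
    (a + b % m) % m  ≡⟨ cong (_% m) (+-comm a (b % m)) ⟩
    (b % m + a) % m  ≡⟨ %-absorbˡ b a ⟩
    (b + a) % m      ≡⟨ cong (_% m) (+-comm b a) ⟩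
    (a + b) % m      ∎

  +-cong-% : ∀ {a b} t → a % m ≡ b % m → (a + t) % m ≡ (b + t) % m
  +-cong-% {a} {b} t a≡b = begin
    (a + t) % m      ≡⟨ %-absorbˡ a t ⟨
    (a % m + t) % m  ≡⟨ cong (λ x → (x + t) % m) a≡b ⟩
    (b % m + t) % m  ≡⟨ %-absorbˡ b t ⟩
    (b + t) % m      ∎

  residue-offset : ∀ c (y : Fin m) → ∃ λ t → t < m × y ≡ (c + t) mod m
  residue-offset c y = t , m%n<n _ m , Finₚ.toℕ-injective (sym c+t≡y)
    where
    r = c % m
    t = (toℕ y + (m ∸ r)) % m
    c+t≡y : toℕ ((c + t) mod m) ≡ toℕ y
    c+t≡y = begin
      toℕ ((c + t) mod m)        ≡⟨ Finₚ.toℕ-fromℕ< _ ⟩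
      (c + t) % m                ≡⟨ %-absorbʳ c _ ⟩
      (c + (toℕ y + (m ∸ r))) % m ≡⟨ %-absorbˡ c _ ⟨
      (r + (toℕ y + (m ∸ r))) % m ≡⟨ cong (_% m) (x∙yz≈y∙xz r (toℕ y) (m ∸ r)) ⟩
      (toℕ y + (r + (m ∸ r))) % m ≡⟨ cong (λ z → (toℕ y + z) % m) (m+[n∸m]≡n (m%n≤n c m)) ⟩
      (toℕ y + m) % m            ≡⟨ [m+n]%n≡m%n (toℕ y) m ⟩
      toℕ y % m                  ≡⟨ m<n⇒m%n≡m (Finₚ.toℕ<n y) ⟩
      toℕ y                      ∎

  mod-cong : ∀ {a b} → a % m ≡ b % m → a mod m ≡ b mod m
  mod-cong a≡b = Finₚ.toℕ-injective (trans (Finₚ.toℕ-fromℕ< _) (trans a≡b (sym (Finₚ.toℕ-fromℕ< _))))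

  mod-arc : ∀ x → Arc (DirCycle m) (x mod m) (suc x mod m)
  mod-arc x with m≤n⇒m<n∨m≡n (m%n<n x m)
  ... | inj₁ 1+r<m = inj₁ (begin
    suc (toℕ (x mod m))  ≡⟨ cong suc (Finₚ.toℕ-fromℕ< _) ⟩
    suc (x % m)          ≡⟨ m<n⇒m%n≡m 1+r<m ⟨
    suc (x % m) % m      ≡⟨ %-absorbʳ 1 x ⟩
    suc x % m            ≡⟨ Finₚ.toℕ-fromℕ< _ ⟨
    toℕ (suc x mod m)    ∎)
  ... | inj₂ 1+r≡m = inj₂ (trans (cong suc (Finₚ.toℕ-fromℕ< _)) 1+r≡m , (begin
    toℕ (suc x mod m)    ≡⟨ Finₚ.toℕ-fromℕ< _ ⟩
    suc x % m            ≡⟨ %-absorbʳ 1 x ⟨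
    suc (x % m) % m      ≡⟨ cong (_% m) 1+r≡m ⟩
    m % m                ≡⟨ n%n≡0 m ⟩
    0                    ∎))

  arc⇒next : ∀ {a b} → Arc (DirCycle m) a b → b ≡ suc (toℕ a) mod m
  arc⇒next {a} {b} a↦b = Finₚ.toℕ-injective (trans (value a↦b) (sym (Finₚ.toℕ-fromℕ< _)))
    where
    value : Arc (DirCycle m) a b → toℕ b ≡ suc (toℕ a) % m
    value (inj₁ 1+a≡b)          = trans (sym 1+a≡b) (sym (m<n⇒m%n≡m (subst (_< m) (sym 1+a≡b) (Finₚ.toℕ<n b))))
    value (inj₂ (1+a≡m , b≡0)) = trans b≡0 (sym (trans (cong (_% m) 1+a≡m) (n%n≡0 m)))

pred : ∀ {n′} → Fin (suc n′) → Fin (suc n′)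
pred {n′} Fin.zero = fromℕ n′
pred (Fin.suc j)   = inject₁ j

pred-arc : ∀ {n′} (j : Fin (suc n′)) → Arc (DirCycle (suc n′)) (pred j) j
pred-arc {n′} Fin.zero = inj₂ (cong suc (Finₚ.toℕ-fromℕ n′) , refl)
pred-arc (Fin.suc j)   = inj₁ (cong suc (Finₚ.toℕ-inject₁ j))

arc⇒pred : ∀ {n′} {i j : Fin (suc n′)} → Arc (DirCycle (suc n′)) i j → i ≡ pred j
arc⇒pred {n′} {j = Fin.zero}  (inj₁ ())
arc⇒pred {n′} {j = Fin.zero}  (inj₂ (1+i≡n , _)) =
  Finₚ.toℕ-injective (trans (suc-injective 1+i≡n) (sym (Finₚ.toℕ-fromℕ n′)))
arc⇒pred {j = Fin.suc j} (inj₁ 1+i≡1+j) =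
  Finₚ.toℕ-injective (trans (suc-injective 1+i≡1+j) (sym (Finₚ.toℕ-inject₁ j)))
arc⇒pred {j = Fin.suc j} (inj₂ (_ , ()))

∑-pred : ∀ {n′} (g : Fin (suc n′) → ℕ) → ∑[ j < suc n′ ] g (pred j) ≡ ∑[ j < suc n′ ] g j
∑-pred {n′} g = trans (+-comm (g (fromℕ n′)) _) (sym (sum-init-last g))

∑-mono-≤ : ∀ {n} {f g : Fin n → ℕ} → (∀ j → f j ≤ g j) → ∑[ j < n ] f j ≤ ∑[ j < n ] g j
∑-mono-≤ {zero}  f≤g = z≤n
∑-mono-≤ {suc n} f≤g = +-mono-≤ (f≤g Fin.zero) (∑-mono-≤ (f≤g ∘ Fin.suc))

∑-const : ∀ n c → ∑[ j < n ] c ≡ n * c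
∑-const zero    c = refl
∑-const (suc n) c = cong (λ s → c + s) (∑-const n c)

δ : ∀ {n} → Fin n → Fin n → ℕ
δ Fin.zero    Fin.zero    = 1
δ Fin.zero    (Fin.suc _) = 0
δ (Fin.suc _) Fin.zero    = 0
δ (Fin.suc i) (Fin.suc j) = δ i j

δ-refl : ∀ {n} (i : Fin n) → δ i i ≡ 1
δ-refl Fin.zero    = refl
δ-refl (Fin.suc i) = δ-refl i

∑-δ : ∀ {n} (i : Fin n) → ∑[ j < n ] δ i j ≡ 1
∑-δ {suc n} Fin.zero    = cong suc (trans (∑-const n 0) (*-zeroʳ n))
∑-δ         (Fin.suc i) = ∑-δ i

module Columns (m n′ : ℕ) .{{_ : NonZero m}} where
  open Modular m

  Torus : Digraph
  Torus = DirCycle m □ DirCycle (suc n′)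

  Vertex : Set
  Vertex = Fin m × Fin (suc n′)

  columnCount : Fin (suc n′) → List Vertex → ℕ
  columnCount j []            = 0
  columnCount j ((_ , c) ∷ S) = δ c j + columnCount j S

  ∑-columnCount : ∀ S → ∑[ j < suc n′ ] columnCount j S ≡ length S
  ∑-columnCount []            = trans (∑-const (suc n′) 0) (*-zeroʳ (suc n′))
  ∑-columnCount ((_ , c) ∷ S) = begin
    ∑[ j < suc n′ ] (δ c j + columnCount j S)                ≡⟨ ∑-distrib-+ (δ c) (λ j → columnCount j S) ⟩
    ∑[ j < suc n′ ] δ c j + ∑[ j < suc n′ ] columnCount j S  ≡⟨ cong₂ _+_ (∑-δ c) (∑-columnCount S) ⟩
    suc (length S)                                           ∎
    where open ≡-Reasoning

  shadow : Fin (suc n′) → Vertex → List Vertex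
  shadow j (x , c) with c Fin.≟ j | c Fin.≟ pred j
  ... | yes _ | _     = (x , j) ∷ (suc (toℕ x) mod m , j) ∷ []
  ... | no _  | yes _ = (x , j) ∷ []
  ... | no _  | no _  = []

  length-shadow : ∀ j u → length (shadow j u) ≤ 2 * δ (proj₂ u) j + δ (proj₂ u) (pred j)
  length-shadow j (x , c) with c Fin.≟ j | c Fin.≟ pred j
  ... | yes refl | _        rewrite δ-refl j        = s≤s (s≤s z≤n)
  ... | no _     | yes refl rewrite δ-refl (pred j) = m≤n+m 1 _
  ... | no _     | no _                             = z≤n

  shadow-covers : ∀ {u x j} → Dominates Torus u (x , j) → (x , j) ∈ shadow j u
  shadow-covers {_ , j} {j = j} (inj₁ refl) with j Fin.≟ j | j Fin.≟ pred j
  ... | yes _   | _ = here refl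
  ... | no j≢j  | _ = contradiction refl j≢j
  shadow-covers {x′ , j} {j = j} (inj₂ (inj₁ (x′↦x , refl))) with j Fin.≟ j | j Fin.≟ pred j
  ... | yes _   | _ = there (here (cong (_, j) (arc⇒next x′↦x)))
  ... | no j≢j  | _ = contradiction refl j≢j
  shadow-covers {x , c} {j = j} (inj₂ (inj₂ (c↦j , refl))) with c Fin.≟ j | c Fin.≟ pred j
  ... | yes _ | _       = here refl
  ... | no _  | yes _   = here refl
  ... | no _  | no c≢pj = contradiction (arc⇒pred c↦j) c≢pj

  length-shadows : ∀ j S → length (concatMap (shadow j) S) ≤ 2 * columnCount j S + columnCount (pred j) S
  length-shadows j []      = z≤n
  length-shadows j (u ∷ S) = begin
    length (shadow j u ++ concatMap (shadow j) S)       ≡⟨ length-++ (shadow j u) ⟩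
    length (shadow j u) + length (concatMap (shadow j) S) ≤⟨ +-mono-≤ (length-shadow j u) (length-shadows j S) ⟩
    (2 * a + b) + (2 * c + d)                           ≡⟨ regroup a b c d ⟩
    2 * (a + c) + (b + d)                               ∎
    where
    open ≤-Reasoning
    a = δ (proj₂ u) j
    b = δ (proj₂ u) (pred j)
    c = columnCount j S
    d = columnCount (pred j) S
    regroup : ∀ a b c d → (2 * a + b) + (2 * c + d) ≡ 2 * (a + c) + (b + d)
    regroup = solve-∀

  -- Column j consists of m vertices; a member of column j dominates at most two of them and
  -- a member of the preceding column at most one, and no other vertex dominates any of them.
  column-bound : ∀ S → IsDominatingSet Torus S → ∀ j → m ≤ 2 * columnCount j S + columnCount (pred j) S
  column-bound S (_ , dominated) j = begin
    m                                  ≡⟨ trans (length-map (_, j) (allFin m)) (length-tabulate id) ⟨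
    length column                      ≤⟨ unique-⊆⇒length≤ (map⁺ (cong proj₁) (allFin⁺ m)) column⊆shadows ⟩
    length (concatMap (shadow j) S)    ≤⟨ length-shadows j S ⟩
    2 * columnCount j S + columnCount (pred j) S ∎
    where
    open ≤-Reasoning
    column = map (_, j) (allFin m)
    column⊆shadows : ∀ {v} → v ∈ column → v ∈ concatMap (shadow j) S
    column⊆shadows v∈column with ∈-map⁻ (_, j) v∈column
    ... | x , _ , refl with dominated (x , j)
    ...   | u , u∈S , u↦v = ∈-concatMap⁺ (shadow j) (lose u∈S (shadow-covers u↦v))

-- Local trade-off with K = k+1: if 2x + y ≥ 3k+2, then max(x, K) = K + (x ∸ K) ≤ x + (y ∸ K).
-- A column with fewer than K dominators forces a surplus beyond K in the preceding column.
surplus-transfer : ∀ k x y → 3 * k + 2 ≤ 2 * x + y → suc k + (x ∸ suc k) ≤ x + (y ∸ suc k)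
surplus-transfer k x y demand with suc k ≤? x
... | yes K≤x = begin
  suc k + (x ∸ suc k)  ≡⟨ m+[n∸m]≡n K≤x ⟩
  x                    ≤⟨ m≤m+n x _ ⟩
  x + (y ∸ suc k)      ∎
  where open ≤-Reasoning
... | no K≰x = begin
  suc k + (x ∸ suc k)  ≡⟨ cong (λ z → suc k + z) (m≤n⇒m∸n≡0 (≤-trans x≤k (n≤1+n k))) ⟩
  suc k + 0            ≡⟨ +-identityʳ (suc k) ⟩
  suc k                ≤⟨ m+n≤o⇒m≤o∸n (suc k) 2K≤x+y ⟩
  (x + y) ∸ suc k      ≤⟨ m≤n+o⇒m∸n≤o (x + y) (suc k) x+y≤K+rest ⟩
  x + (y ∸ suc k)      ∎
  where
  open ≤-Reasoning
  three-k+2 : ∀ k → k + (suc k + suc k) ≡ 3 * k + 2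
  three-k+2 = solve-∀
  twice-x+y : ∀ x y → 2 * x + y ≡ x + (x + y)
  twice-x+y = solve-∀
  x≤k : x ≤ k
  x≤k = ≤-pred (≰⇒> K≰x)
  2K≤x+y : suc k + suc k ≤ x + y
  2K≤x+y = +-cancelˡ-≤ k _ _ (begin
    k + (suc k + suc k)  ≡⟨ three-k+2 k ⟩
    3 * k + 2            ≤⟨ demand ⟩
    2 * x + y            ≡⟨ twice-x+y x y ⟩
    x + (x + y)          ≤⟨ +-monoˡ-≤ (x + y) x≤k ⟩
    k + (x + y)          ∎)
  x+y≤K+rest : x + y ≤ suc k + (x + (y ∸ suc k))
  x+y≤K+rest = begin
    x + y                        ≤⟨ +-monoʳ-≤ x (m≤n+m∸n y (suc k)) ⟩
    x + (suc k + (y ∸ suc k))    ≡⟨ x∙yz≈y∙xz x (suc k) (y ∸ suc k) ⟩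
    suc k + (x + (y ∸ suc k))    ∎

-- If every column j of a cycle of columns satisfies the demand 3k+2 ≤ 2dⱼ + d_{pred j},
-- then the dⱼ average at least k+1: sum the surplus transfers around the cycle and cancel
-- the total surplus, which is invariant under rotation.
cyclic-demand : ∀ {n′} k (d : Fin (suc n′) → ℕ) → (∀ j → 3 * k + 2 ≤ 2 * d j + d (pred j)) →
                suc n′ * suc k ≤ ∑[ j < suc n′ ] d j
cyclic-demand {n′} k d demand = +-cancelʳ-≤ surplus _ _ (begin
  suc n′ * K + surplus                                  ≡⟨ cong (_+ surplus) (∑-const (suc n′) K) ⟨
  ∑[ j < suc n′ ] K + surplus                           ≡⟨ ∑-distrib-+ (λ _ → K) (λ j → d j ∸ K) ⟨
  ∑[ j < suc n′ ] (K + (d j ∸ K))                       ≤⟨ ∑-mono-≤ (λ j → surplus-transfer k (d j) (d (pred j)) (demand j)) ⟩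
  ∑[ j < suc n′ ] (d j + (d (pred j) ∸ K))              ≡⟨ ∑-distrib-+ d (λ j → d (pred j) ∸ K) ⟩
  ∑[ j < suc n′ ] d j + ∑[ j < suc n′ ] (d (pred j) ∸ K) ≡⟨ cong (λ z → ∑[ j < suc n′ ] d j + z) (∑-pred (λ j → d j ∸ K)) ⟩
  ∑[ j < suc n′ ] d j + surplus                         ∎)
  where
  open ≤-Reasoning
  K = suc k
  surplus = ∑[ j < suc n′ ] (d j ∸ K)

3k+2-nonZero : ∀ k → NonZero (3 * k + 2)
3k+2-nonZero k = >-nonZero (≤-<-trans z≤n (m<m+n (3 * k) z<s))

lower-bound : ∀ k n′ S → IsDominatingSet (DirCycle (3 * k + 2) □ DirCycle (suc n′)) S →
              suc n′ * suc k ≤ length S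
lower-bound k n′ S isDominating = begin
  suc n′ * suc k                           ≤⟨ cyclic-demand k (λ j → columnCount j S) (column-bound S isDominating) ⟩
  ∑[ j < suc n′ ] columnCount j S          ≡⟨ ∑-columnCount S ⟩
  length S                                 ∎
  where
  open ≤-Reasoning
  open Columns (3 * k + 2) n′ {{3k+2-nonZero k}}

module UpperBound (k : ℕ) where

  m : ℕ
  m = 3 * k + 2

  instance
    m-nonZero : NonZero m
    m-nonZero = 3k+2-nonZero k

  open Modular m

  ShiftStep : ℕ → ℕ → Set
  ShiftStep c′ c = (c % m ≡ (c′ + 1) % m) ⊎ (c % m ≡ (c′ + 3 * k) % m)

  q*3<m⇒q≤k : ∀ q → q * 3 < m → q < suc k
  q*3<m⇒q≤k q q*3<m = *-cancelʳ-< 3 q (suc k) (<-≤-trans q*3<m (≤-trans (n≤1+n m) (≤-reflexive (bound k))))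
    where
    bound : ∀ k → suc (3 * k + 2) ≡ suc k * 3
    bound = solve-∀

  2+q*3<m⇒q<k : ∀ q → 2 + q * 3 < m → q < k
  2+q*3<m⇒q<k q 2+q*3<m = *-cancelʳ-< 3 q k (+-cancelˡ-< 2 (q * 3) (k * 3) (<-≤-trans 2+q*3<m (≤-reflexive (bound k))))
    where
    bound : ∀ k → 3 * k + 2 ≡ 2 + k * 3
    bound = solve-∀

  module Cells {n′ : ℕ} (offset : Fin (suc n′) → ℕ) (steps : ∀ j → ShiftStep (offset (pred j)) (offset j)) where
    open Columns m n′ using (Torus; Vertex)

    cell : Fin (suc n′) → ℕ → Vertex
    cell j q = ((offset j + q * 3) mod m , j)

    cellAt : Fin (suc n′) × Fin (suc k) → Vertex
    cellAt (j , i) = cell j (toℕ i)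

    cells : List Vertex
    cells = tabulate (cellAt ∘ remQuot (suc k))

    length-cells : length cells ≡ suc n′ * suc k
    length-cells = length-tabulate (cellAt ∘ remQuot (suc k))

    cell∈cells : ∀ j q → q < suc k → cell j q ∈ cells
    cell∈cells j q q<K = subst (_∈ cells) chosen (∈-tabulate⁺ {f = cellAt ∘ remQuot (suc k)} (combine j i))
      where
      i = fromℕ< q<K
      chosen : cellAt (remQuot (suc k) (combine j i)) ≡ cell j q
      chosen = trans (cong cellAt (Finₚ.remQuot-combine j i)) (cong (cell j) (Finₚ.toℕ-fromℕ< q<K))

    -- The vertex at offset t < m from the base point of column j is dominated by a cell:
    -- offsets 3q and 3q+1 by cell j q, offset 3q+2 by a cell of the preceding column.
    offset-dominated : ∀ j t → t < m → ∃ λ u → u ∈ cells × Dominates Torus u ((offset j + t) mod m , j)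
    offset-dominated j t t<m with t divMod 3
    ... | result q Fin.zero refl = cell j q , cell∈cells j q (q*3<m⇒q≤k q t<m) , inj₁ refl
    ... | result q (Fin.suc Fin.zero) refl =
      cell j q , cell∈cells j q (q*3<m⇒q≤k q (≤-<-trans (n≤1+n _) t<m)) , inj₂ (inj₁ (next , refl))
      where
      next : Arc (DirCycle m) ((offset j + q * 3) mod m) ((offset j + suc (q * 3)) mod m)
      next = subst (λ z → Arc (DirCycle m) ((offset j + q * 3) mod m) (z mod m)) (sym (+-suc (offset j) (q * 3))) (mod-arc (offset j + q * 3))
    ... | result q (Fin.suc (Fin.suc Fin.zero)) refl = from-preceding (steps j)
      where
      c c′ : ℕ
      c  = offset j
      c′ = offset (pred j)
      q<k : q < k
      q<k = 2+q*3<m⇒q<k q t<m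
      open ≡-Reasoning
      from-preceding : ShiftStep c′ c → ∃ λ u → u ∈ cells × Dominates Torus u ((c + (2 + q * 3)) mod m , j)
      from-preceding (inj₁ c≡c′+1) =
        cell (pred j) (suc q) , cell∈cells (pred j) (suc q) (s≤s q<k) , inj₂ (inj₂ (pred-arc j , mod-cong (begin
          (c′ + suc q * 3) % m          ≡⟨ cong (_% m) (one-step c′ q) ⟩
          (c′ + 1 + (2 + q * 3)) % m    ≡⟨ +-cong-% (2 + q * 3) c≡c′+1 ⟨
          (c + (2 + q * 3)) % m         ∎)))
        where
        one-step : ∀ c′ q → c′ + suc q * 3 ≡ c′ + 1 + (2 + q * 3)
        one-step = solve-∀
      from-preceding (inj₂ c≡c′+3k) =
        cell (pred j) q , cell∈cells (pred j) q (m<n⇒m<1+n q<k) , inj₂ (inj₂ (pred-arc j , mod-cong (begin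
          (c′ + q * 3) % m              ≡⟨ [m+n]%n≡m%n (c′ + q * 3) m ⟨
          (c′ + q * 3 + m) % m          ≡⟨ cong (_% m) (long-step c′ q k) ⟩
          (c′ + 3 * k + (2 + q * 3)) % m ≡⟨ +-cong-% (2 + q * 3) c≡c′+3k ⟨
          (c + (2 + q * 3)) % m         ∎)))
        where
        long-step : ∀ c′ q k → c′ + q * 3 + (3 * k + 2) ≡ c′ + 3 * k + (2 + q * 3)
        long-step = solve-∀

    cells-cover : Covers Torus cells
    cells-cover (y , j) with residue-offset (offset j) y
    ... | t , t<m , refl = offset-dominated j t t<m

  -- The staircase: A steps of 1 followed by steps of 3k.
  staircase : ℕ → ℕ → ℕ
  staircase zero    j       = j * (3 * k)
  staircase (suc A) zero    = 0
  staircase (suc A) (suc j) = suc (staircase A j)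

  staircase-zero : ∀ A → staircase A 0 ≡ 0
  staircase-zero zero    = refl
  staircase-zero (suc A) = refl

  staircase-step : ∀ A j → (staircase A (suc j) ≡ staircase A j + 1) ⊎ (staircase A (suc j) ≡ staircase A j + 3 * k)
  staircase-step zero    j       = inj₂ (+-comm (3 * k) (j * (3 * k)))
  staircase-step (suc A) zero    = inj₁ (cong suc (staircase-zero A))
  staircase-step (suc A) (suc j) = Sum.map (cong suc) (cong suc) (staircase-step A j)

  staircase-end : ∀ A B → staircase A (A + B) ≡ A + B * (3 * k)
  staircase-end zero    B = refl
  staircase-end (suc A) B = cong suc (staircase-end A B)

  staircase-steps : ∀ A n′ → m ∣ℕ staircase A (suc n′) →
                    ∀ (j : Fin (suc n′)) → ShiftStep (staircase A (toℕ (pred j))) (staircase A (toℕ j))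
  staircase-steps A n′ m∣end Fin.zero
    rewrite Finₚ.toℕ-fromℕ n′ | staircase-zero A =
      Sum.map (trans back-to-0) (trans back-to-0) (Sum.map (cong (_% m)) (cong (_% m)) (staircase-step A n′))
    where
    back-to-0 : 0 % m ≡ staircase A (suc n′) % m
    back-to-0 = trans (m<n⇒m%n≡m (>-nonZero⁻¹ m)) (sym (n∣m⇒m%n≡0 (staircase A (suc n′)) m m∣end))
  staircase-steps A n′ m∣end (Fin.suc j)
    rewrite Finₚ.toℕ-inject₁ j = Sum.map (cong (_% m)) (cong (_% m)) (staircase-step A (toℕ j))

torus-γ : ∀ k n′ A B → A + B ≡ suc n′ → (3 * k + 2) ∣ℕ A + B * (3 * k) →
          DominationNumber≡ (DirCycle (3 * k + 2) □ DirCycle (suc n′)) (suc n′ * (k + 1))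
torus-γ k n′ A B A+B≡n m∣AB = subst (λ K → DominationNumber≡ Torus (suc n′ * K)) (+-comm 1 k)
  (γ-from-bounds Torus (≡-dec Fin._≟_ Fin._≟_) (suc n′ * suc k) (lower-bound k n′) cells cells-cover (≤-reflexive length-cells))
  where
  open UpperBound k
  closes : m ∣ℕ staircase A (suc n′)
  closes = subst (λ z → m ∣ℕ staircase A z) A+B≡n (subst (m ∣ℕ_) (sym (staircase-end A B)) m∣AB)
  open Columns m n′ using (Torus)
  open Cells (λ j → staircase A (toℕ j)) (staircase-steps A n′ closes)

-- An integer divisibility m ∣ (x - u) - v transfers to m ∣ x + w in ℕ whenever u + v + w is a
-- multiple of m, because x + w = ((x - u) - v) + (u + v + w).
shifted-divisibility : ∀ m x u v w c → (+ m) ∣ ((+ x - + u) - + v) → u + v + w ≡ c * m → m ∣ℕ x + w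
shifted-divisibility m x u v w c m∣xuv u+v+w≡cm =
  Signed.∣⇒∣ᵤ (subst (Signed._∣_ (+ m)) lifted
    (Signed.∣m∣n⇒∣m+n (Signed.∣ᵤ⇒∣ {i = d} m∣xuv) (Signed.∣n⇒∣m*n (+ c) (Signed.∣-refl {+ m}))))
  where
  open ≡-Reasoning
  d = (+ x - + u) - + v
  cancel : ∀ X U V W → ((X - U) - V) ℤ.+ ((U ℤ.+ V) ℤ.+ W) ≡ X ℤ.+ W
  cancel = ℤ-solve-∀
  lifted : d ℤ.+ (+ c) ℤ.* (+ m) ≡ + (x + w)
  lifted = begin
    d ℤ.+ (+ c) ℤ.* (+ m)              ≡⟨ cong (λ z → d ℤ.+ z) (ℤₚ.pos-* c m) ⟨
    d ℤ.+ + (c * m)                    ≡⟨ cong (λ z → d ℤ.+ + z) u+v+w≡cm ⟨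
    d ℤ.+ + (u + v + w)                ≡⟨ cong (λ z → d ℤ.+ z) (trans (ℤₚ.pos-+ (u + v) w) (cong (λ z → z ℤ.+ + w) (ℤₚ.pos-+ u v))) ⟩
    d ℤ.+ ((+ u ℤ.+ + v) ℤ.+ + w)      ≡⟨ cancel (+ x) (+ u) (+ v) (+ w) ⟩
    + x ℤ.+ + w                        ≡⟨ ℤₚ.pos-+ x w ⟨
    + (x + w)                          ∎

-- First alternative of the hypothesis, a - 2b ≡ 2 (mod 3k+2): take A = a, B = b+1.
first-alternative : ∀ k a b → (+ (3 * k + 2)) ∣ ((+ a - (+ (2 * b))) - + 2) →
                    (3 * k + 2) ∣ℕ a + suc b * (3 * k)
first-alternative k a b h = shifted-divisibility (3 * k + 2) a (2 * b) 2 (suc b * (3 * k)) (suc b) h (multiple b k)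
  where
  multiple : ∀ b k → 2 * b + 2 + suc b * (3 * k) ≡ suc b * (3 * k + 2)
  multiple = solve-∀

-- Second alternative, a - 2b ≡ 3k+1 (mod 3k+2): take A = a+1, B = b.
second-alternative : ∀ k a b → (+ (3 * k + 2)) ∣ ((+ a - (+ (2 * b))) - + ((3 * k + 2) ∸ 1)) →
                     (3 * k + 2) ∣ℕ suc a + b * (3 * k)
second-alternative k a b h = subst (λ z → (3 * k + 2) ∣ℕ z) (+-suc a (b * (3 * k)))
  (shifted-divisibility (3 * k + 2) a (2 * b) ((3 * k + 2) ∸ 1) (suc (b * (3 * k))) (suc b) h
    (trans (cong (λ z → 2 * b + z + suc (b * (3 * k))) (+-∸-assoc (3 * k) (s≤s z≤n))) (multiple b k)))
  where
  multiple : ∀ b k → 2 * b + (3 * k + 1) + suc (b * (3 * k)) ≡ suc b * (3 * k + 2)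
  multiple = solve-∀

mainTheorem4 : (n k₁ : ℕ) → 2 ≤ n →
    let m = 3 * k₁ + 2 in
    (Σ ℕ λ a → Σ ℕ λ b → (a + b ≡ n ∸ 1) ×
      (((+ m) ∣ ((+ a - (+ (2 * b))) - + 2)) ⊎ ((+ m) ∣ ((+ a - (+ (2 * b))) - + (m ∸ 1))))) →
    DominationNumber≡ (DirCycle m □ DirCycle n) (n * (k₁ + 1))
mainTheorem4 (suc n′) k (s≤s _) (a , b , a+b≡n′ , inj₁ h) =
  torus-γ k n′ a (suc b) (trans (+-suc a b) (cong suc a+b≡n′)) (first-alternative k a b h)
mainTheorem4 (suc n′) k (s≤s _) (a , b , a+b≡n′ , inj₂ h) =
  torus-γ k n′ (suc a) b (cong suc a+b≡n′) (second-alternative k a b h)
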